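{- The wreath product $\mathrm{Av}(25134)\wr\mathrm{Av}(321)$ is not finitely based.
   Context: Permutations of length $n$ are sequences of $1,\dots,n$; $\sigma$ is involved in $\pi$ if some subsequence of $\pi$ is order isomorphic to $\sigma$. $\mathrm{Av}(B)$ is the set of permutations involving no element of $B$. A permutation class (downset under involvement) is finitely based if the set of minimal permutations not in it is finite. For $\sigma\in S_m$ and nonempty $\alpha_1,\dots,\alpha_m$, the inflation $\sigma[\alpha_1,\dots,\alpha_m]$ replaces each entry $\sigma(i)$ by a block of consecutive positions with consecutive values order isomorphic to $\alpha_i$, arranged as the entries of $\sigma$. The wreath product $X\wr Y$ is the set of all $\sigma[\alpha_1,\dots,\alpha_m]$ with $\sigma\in X$ and all $\alpha_i\in Y$. -}

module Defs where

open import Data.Nat using (ℕ; zero; suc; _+_; _<_; _<ᵇ_)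
open import Data.Bool using (if_then_else_)
open import Data.List using (List; []; _∷_; length; map; concat; zipWith; upTo)
open import Data.Nat.ListAction using (sum)
open import Data.List.Relation.Unary.All using (All)
open import Data.List.Relation.Unary.AllPairs using (AllPairs)
open import Data.List.Relation.Binary.Sublist.Propositional using (_⊆_)
open import Data.List.Relation.Binary.Permutation.Propositional using (_↭_)
open import Data.Product using (Σ; ∃; _×_; _,_)
open import Function.Bundles using (_⇔_)
open import Relation.Nullary using (¬_)
open import Relation.Binary.PropositionalEquality using (_≡_; _≢_)
open import Data.List.Membership.Propositional using (_∈_)

Perm : List ℕ → Set
Perm π = π ↭ map suc (upTo (length π))

data OrdIso : List ℕ → List ℕ → Set where
  ordIso : ∀ {xs ys} → length xs ≡ length ys →
    AllPairs (λ p q → ((Data.Product.proj₁ p < Data.Product.proj₁ q) ⇔ (Data.Product.proj₂ p < Data.Product.proj₂ q))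
                    × ((Data.Product.proj₁ q < Data.Product.proj₁ p) ⇔ (Data.Product.proj₂ q < Data.Product.proj₂ p)))
             (Data.List.zip xs ys) →
    OrdIso xs ys

_≼_ : List ℕ → List ℕ → Set
σ ≼ π = ∃ λ τ → τ ⊆ π × OrdIso σ τ

Av : List (List ℕ) → List ℕ → Set
Av B π = Perm π × All (λ β → ¬ (β ≼ π)) B

-- Inflation σ[α₁,…,αₘ]: block i is αᵢ shifted up by the total size of the
-- blocks αⱼ with σ(j) < σ(i); blocks are concatenated in position order.
offset : List ℕ → List (List ℕ) → ℕ → ℕ
offset σ αs s = sum (zipWith (λ t α → if t <ᵇ s then length α else 0) σ αs)

inflate : List ℕ → List (List ℕ) → List ℕ
inflate σ αs = concat (zipWith (λ s α → map (offset σ αs s +_) α) σ αs)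

Wreath : (List ℕ → Set) → (List ℕ → Set) → List ℕ → Set
Wreath X Y π =
  Σ (List ℕ) λ σ → Σ (List (List ℕ)) λ αs →
    X σ × length αs ≡ length σ
    × All (λ α → 0 < length α × Y α) αs
    × π ≡ inflate σ αs

MinimalNonMember : (List ℕ → Set) → List ℕ → Set
MinimalNonMember C π =
  Perm π × ¬ C π × (∀ σ → Perm σ → σ ≼ π → σ ≢ π → C σ)

FinitelyBased : (List ℕ → Set) → Set
FinitelyBased C = ∃ λ (L : List (List ℕ)) → ∀ π → MinimalNonMember C π → π ∈ L

-- For m ≥ 2 let π m = 2 5 1 3 · 7 4 9 6 ⋯ (2m+5) (2m+2) · (2m+7) (2m+6) (2m+4): an increasing
-- oscillation anchored by 2 5 1 3 on the left and by a copy of 321 on the right. These permutations are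
-- basis elements of 𝒞 = Av(25134) ≀ Av(321) of unbounded length.
--   π m ∉ 𝒞: the blocks of an inflation are intervals of values. The first block cannot be longer than
-- one entry, as π m is sum-indecomposable; each of the next five entries has an earlier entry whose
-- value lies between it and its successor. So 2 5 1 3 7 4 are singleton blocks and the skeleton
-- contains 25134, unless the skeleton is 1, in which case the single block π m contains 321.
--   Every proper pattern of π m is in 𝒞: the only 25134 in π m is 2 5 1 3 4 and its only 321 is the
-- final one, so deleting one of their entries leaves a 25134-avoider ρ = ρ[1, …, 1] or a 321-avoider
-- ρ = 1[ρ]. Deleting any other entry cuts the oscillation, leaving a sum A ⊕ B with A avoiding 321
-- and B avoiding 25134, which is (1 ⊕ B)[A, 1, …, 1].

module Submission where

open import Defs
open import Data.Bool as Bool using (true; false; if_then_else_)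
open import Data.Bool.Properties using (T-≡)
open import Data.Empty using (⊥; ⊥-elim)
open import Data.List using (List; []; _∷_; length; map; _++_; zip; concat; zipWith; replicate; upTo; applyUpTo)
open import Data.List.Extrema.Nat using (max; xs≤max)
open import Data.List.Membership.Propositional using (_∈_; _∉_)
open import Data.List.Membership.Propositional.Properties
  using (∈-map⁺; ∈-map⁻; ∈-upTo⁺; ∈-upTo⁻; ∈-∃++; ∈-++⁺ˡ; ∈-++⁺ʳ; ∈-++⁻)
open import Data.List.Membership.Propositional.Properties.WithK using (unique∧set⇒bag)
open import Data.List.Properties
  using (map-id; map-id-local; map-cong-local; map-∘; map-++; map-upTo; length-map; length-++; length-upTo;
         length-replicate; ++-assoc; ++-identityʳ; ++-conicalʳ; ∷-injective; ∷-injectiveˡ; ∷-injectiveʳ)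
open import Data.List.Relation.Binary.BagAndSetEquality using (∼bag⇒↭)
open import Data.List.Relation.Binary.Permutation.Propositional using (_↭_; prep; ↭-refl; ↭-sym; ↭⇒↭ₛ)
open import Data.List.Relation.Binary.Permutation.Propositional.Properties as ↭ using (∈-resp-↭; ↭-length; shift)
import Data.List.Relation.Binary.Permutation.Setoid.Properties as PermSetoid
open import Data.List.Relation.Binary.Pointwise as PW using (Pointwise; []; _∷_; Pointwise-≡⇒≡)
open import Data.List.Relation.Binary.Sublist.Heterogeneous.Properties using (toPointwise)
open import Data.List.Relation.Binary.Sublist.Propositional using (_⊆_; []; _∷_; _∷ʳ_; ⊆-refl; ⊆-trans; minimum)
open import Data.List.Relation.Binary.Sublist.Propositional.Properties as Sublist
  using (All-resp-⊆; Any-resp-⊆; length-mono-≤; ++⁺ˡ; ++⁺ʳ)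
open import Data.List.Relation.Unary.All as All using (All; []; _∷_)
open import Data.List.Relation.Unary.All.Properties as All using (All¬⇒¬Any)
open import Data.List.Relation.Unary.AllPairs as AllPairs using (AllPairs; []; _∷_)
import Data.List.Relation.Unary.AllPairs.Properties as AllPairs
open import Data.List.Relation.Unary.Any using (here; there)
open import Data.List.Relation.Unary.Unique.Propositional using (Unique)
import Data.List.Relation.Unary.Unique.Propositional.Properties as Unique
open import Data.Nat using (ℕ; zero; suc; pred; _+_; _∸_; _<_; _≤_; _<ᵇ_; z≤n; s≤s; _<?_)
open import Data.Nat.ListAction using (sum)
open import Data.Nat.ListAction.Properties using (sum-↭)
open import Data.Nat.Properties
open import Data.List.Membership.DecPropositional _≟_ using (_∈?_)
open import Data.Product using (∃-syntax; _×_; _,_; proj₁; proj₂)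
open import Data.Sum using (_⊎_; inj₁; inj₂)
open import Data.Unit using (⊤; tt)
open import Function.Base using (_∘_; id)
open import Function.Bundles using (_⇔_; mk⇔; Equivalence)
open import Function.Construct.Composition using (_⇔-∘_)
open import Function.Construct.Identity using (⇔-id)
open import Function.Construct.Symmetry using (⇔-sym)
open import Relation.Binary.Definitions using (tri<; tri≈; tri>)
open import Relation.Binary.PropositionalEquality
open import Relation.Nullary using (¬_; yes; no)

private
  variable
    i j m x y z x′ y′ z′ : ℕ
    xs ys zs us : List ℕ


AllPairs-resp-⊆ : ∀ {A : Set} {R : A → A → Set} {as bs} → as ⊆ bs → AllPairs R bs → AllPairs R as
AllPairs-resp-⊆ []         []       = []
AllPairs-resp-⊆ (_ ∷ʳ τ)   (_ ∷ rs) = AllPairs-resp-⊆ τ rs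
AllPairs-resp-⊆ (refl ∷ τ) (r ∷ rs) = All-resp-⊆ τ r ∷ AllPairs-resp-⊆ τ rs

AllPairs-++-cross : ∀ {A : Set} {R : A → A → Set} {xs ys x y} → AllPairs R (xs ++ ys) → x ∈ xs → y ∈ ys → R x y
AllPairs-++-cross {xs = _ ∷ xs} (r ∷ _)  (here refl) y∈ = All.lookup r (∈-++⁺ʳ xs y∈)
AllPairs-++-cross              (_ ∷ rs) (there x∈)  y∈ = AllPairs-++-cross rs x∈ y∈

Pointwise-++⁻ : ∀ {R : ℕ → ℕ → Set} {ws xs ys zs} → length ws ≡ length xs →
                Pointwise R (ws ++ ys) (xs ++ zs) → Pointwise R ws xs × Pointwise R ys zs
Pointwise-++⁻ {ws = []}    {[]}    _  p       = [] , p
Pointwise-++⁻ {ws = _ ∷ _} {_ ∷ _} eq (r ∷ p) with Pointwise-++⁻ (suc-injective eq) p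
... | pw , py = r ∷ pw , py

All-pullback : ∀ {R : ℕ → ℕ → Set} {P Q : ℕ → Set} → (∀ {u v} → R u v → Q v → P u) →
                Pointwise R xs ys → All Q ys → All P xs
All-pullback f []      []       = []
All-pullback f (r ∷ p) (q ∷ qs) = f r q ∷ All-pullback f p qs

⊆-map⁻ : ∀ {A : Set} (f : A → ℕ) {xs} ys → xs ⊆ map f ys → ∃[ zs ] zs ⊆ ys × xs ≡ map f zs
⊆-map⁻ f []       []         = [] , [] , refl
⊆-map⁻ f (y ∷ ys) (_ ∷ʳ τ)   with zs , τ′ , refl ← ⊆-map⁻ f ys τ = zs , y ∷ʳ τ′ , refl
⊆-map⁻ f (y ∷ ys) (refl ∷ τ) with zs , τ′ , refl ← ⊆-map⁻ f ys τ = y ∷ zs , refl ∷ τ′ , refl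

⊆-++⁻ : ∀ {A : Set} {xs} (ys zs : List A) → xs ⊆ ys ++ zs →
        ∃[ xs₁ ] ∃[ xs₂ ] xs ≡ xs₁ ++ xs₂ × xs₁ ⊆ ys × xs₂ ⊆ zs
⊆-++⁻ []       zs τ          = [] , _ , refl , [] , τ
⊆-++⁻ (y ∷ ys) zs (_ ∷ʳ τ) with xs₁ , xs₂ , refl , τ₁ , τ₂ ← ⊆-++⁻ ys zs τ =
  xs₁ , xs₂ , refl , y ∷ʳ τ₁ , τ₂
⊆-++⁻ (y ∷ ys) zs (refl ∷ τ) with xs₁ , xs₂ , refl , τ₁ , τ₂ ← ⊆-++⁻ ys zs τ =
  y ∷ xs₁ , xs₂ , refl , refl ∷ τ₁ , τ₂

⊆-missing : ∀ {A : Set} {xs ys : List A} → xs ⊆ ys → Unique ys → length xs < length ys → ∃[ y ] y ∈ ys × y ∉ xs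
⊆-missing (y ∷ʳ τ)   (y∉ys ∷ _) _ = y , here refl , All¬⇒¬Any y∉ys ∘ Any-resp-⊆ τ
⊆-missing (refl ∷ τ) (y∉ys ∷ u) (s≤s shorter) with z , z∈ys , z∉xs ← ⊆-missing τ u shorter =
  z , there z∈ys , λ { (here refl) → All¬⇒¬Any y∉ys z∈ys ; (there z∈xs) → z∉xs z∈xs }

⊆-full : ∀ {A : Set} {xs ys : List A} → xs ⊆ ys → length ys ≤ length xs → xs ≡ ys
⊆-full τ long = Pointwise-≡⇒≡ (toPointwise (≤-antisym (length-mono-≤ τ) long) τ)

T-⇔⇒≡ : ∀ {b c} → (Bool.T b ⇔ Bool.T c) → b ≡ c
T-⇔⇒≡ {false} {false} _ = refl
T-⇔⇒≡ {false} {true}  e = ⊥-elim (Equivalence.from e _)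
T-⇔⇒≡ {true}  {false} e = ⊥-elim (Equivalence.to e _)
T-⇔⇒≡ {true}  {true}  _ = refl

<ᵇ-cong : ∀ {a b c d} → (a < b ⇔ c < d) → (a <ᵇ b) ≡ (c <ᵇ d)
<ᵇ-cong {a} {b} {c} {d} e =
  T-⇔⇒≡ (mk⇔ (<⇒<ᵇ ∘ Equivalence.to e ∘ <ᵇ⇒< a b) (<⇒<ᵇ ∘ Equivalence.from e ∘ <ᵇ⇒< c d))

<ᵇ-irrefl : ∀ s → (s <ᵇ s) ≡ false
<ᵇ-irrefl zero    = refl
<ᵇ-irrefl (suc s) = <ᵇ-irrefl s

<⇒<ᵇ≡true : ∀ {t s} → t < s → (t <ᵇ s) ≡ true
<⇒<ᵇ≡true t<s = Equivalence.to T-≡ (<⇒<ᵇ t<s)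

-- Order isomorphism

Agree : ℕ → ℕ → ℕ → ℕ → Set
Agree x y x′ y′ = (x < x′ ⇔ y < y′) × (x′ < x ⇔ y′ < y)

infix 4 _≅_

data _≅_ : List ℕ → List ℕ → Set where
  []  : [] ≅ []
  _∷_ : Pointwise (Agree x y) xs ys → xs ≅ ys → x ∷ xs ≅ y ∷ ys

Agree-refl : Agree x x x′ x′
Agree-refl = ⇔-id _ , ⇔-id _

Agree-sym : Agree x y x′ y′ → Agree y x y′ x′
Agree-sym (p , q) = ⇔-sym p , ⇔-sym q

Agree-trans : Agree x y x′ y′ → Agree y z y′ z′ → Agree x z x′ z′
Agree-trans (p , q) (p′ , q′) = p′ ⇔-∘ p , q′ ⇔-∘ q

descent : Agree x y x′ y′ → x′ < x → y′ < y
descent agree = Equivalence.to (proj₂ agree)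

Agree-descents : ∀ {x y x′ y′} → x′ < x → y′ < y → Agree x y x′ y′
Agree-descents x′<x y′<y =
  mk⇔ (λ x<x′ → ⊥-elim (<-asym x<x′ x′<x)) (λ y<y′ → ⊥-elim (<-asym y<y′ y′<y)) ,
  mk⇔ (λ _ → y′<y) (λ _ → x′<x)

≅-length : xs ≅ ys → length xs ≡ length ys
≅-length []      = refl
≅-length (_ ∷ o) = cong suc (≅-length o)

≅-refl : ∀ xs → xs ≅ xs
≅-refl []       = []
≅-refl (x ∷ xs) = diagonal xs ∷ ≅-refl xs
  where
  diagonal : ∀ xs → Pointwise (Agree x x) xs xs
  diagonal []       = []
  diagonal (_ ∷ xs) = Agree-refl ∷ diagonal xs

≅-sym : xs ≅ ys → ys ≅ xs
≅-sym []      = []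
≅-sym (p ∷ o) = PW.symmetric Agree-sym p ∷ ≅-sym o

≅-trans : xs ≅ ys → ys ≅ zs → xs ≅ zs
≅-trans []      []      = []
≅-trans (p ∷ o) (q ∷ r) = PW.transitive Agree-trans p q ∷ ≅-trans o r

Pointwise⇒All-zip : ∀ {R : ℕ → ℕ → Set} → Pointwise R xs ys → All (λ p → R (proj₁ p) (proj₂ p)) (zip xs ys)
Pointwise⇒All-zip []      = []
Pointwise⇒All-zip (r ∷ p) = r ∷ Pointwise⇒All-zip p

All-zip⇒Pointwise : ∀ {R : ℕ → ℕ → Set} xs ys → length xs ≡ length ys →
                    All (λ p → R (proj₁ p) (proj₂ p)) (zip xs ys) → Pointwise R xs ys
All-zip⇒Pointwise []       []       _  _       = []
All-zip⇒Pointwise (x ∷ xs) (y ∷ ys) eq (r ∷ a) = r ∷ All-zip⇒Pointwise xs ys (suc-injective eq) a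

OrdIso⇒≅ : OrdIso xs ys → xs ≅ ys
OrdIso⇒≅ (ordIso eq pairs) = go _ _ eq pairs
  where
  go : ∀ xs ys → length xs ≡ length ys → AllPairs _ (zip xs ys) → xs ≅ ys
  go []       []       _  []         = []
  go (x ∷ xs) (y ∷ ys) eq (a ∷ rest) =
    All-zip⇒Pointwise xs ys (suc-injective eq) a ∷ go xs ys (suc-injective eq) rest

≅⇒OrdIso : xs ≅ ys → OrdIso xs ys
≅⇒OrdIso o = ordIso (≅-length o) (go o)
  where
  go : xs ≅ ys → AllPairs _ (zip xs ys)
  go []      = []
  go (p ∷ o) = Pointwise⇒All-zip p ∷ go o

select : us ⊆ xs → List ℕ → List ℕ
select (_ ∷ʳ τ) (_ ∷ ys) = select τ ys
select (_ ∷ τ)  (y ∷ ys) = y ∷ select τ ys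
select _        _        = []

select-⊆ : (τ : us ⊆ xs) (ys : List ℕ) → select τ ys ⊆ ys
select-⊆ []       ys       = minimum ys
select-⊆ (_ ∷ʳ τ) []       = []
select-⊆ (_ ∷ʳ τ) (y ∷ ys) = y ∷ʳ select-⊆ τ ys
select-⊆ (_ ∷ τ)  []       = []
select-⊆ (_ ∷ τ)  (y ∷ ys) = refl ∷ select-⊆ τ ys

Pointwise-select : ∀ {R : ℕ → ℕ → Set} → Pointwise R xs ys → (τ : us ⊆ xs) → Pointwise R us (select τ ys)
Pointwise-select []      []          = []
Pointwise-select (_ ∷ p) (_ ∷ʳ τ)    = Pointwise-select p τ
Pointwise-select (r ∷ p) (refl ∷ τ)  = r ∷ Pointwise-select p τ

≅-select : xs ≅ ys → (τ : us ⊆ xs) → us ≅ select τ ys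
≅-select []      []         = []
≅-select (_ ∷ o) (_ ∷ʳ τ)   = ≅-select o τ
≅-select (p ∷ o) (refl ∷ τ) = Pointwise-select p τ ∷ ≅-select o τ

≼-respʳ-≅ : ∀ {σ π ρ} → σ ≼ π → π ≅ ρ → σ ≼ ρ
≼-respʳ-≅ {ρ = ρ} (τ , τ⊆π , σ≅τ) π≅ρ =
  select τ⊆π ρ , select-⊆ τ⊆π ρ , ≅⇒OrdIso (≅-trans (OrdIso⇒≅ σ≅τ) (≅-select π≅ρ τ⊆π))

≼-respʳ-⊆ : ∀ {σ π ρ} → σ ≼ π → π ⊆ ρ → σ ≼ ρ
≼-respʳ-⊆ (τ , τ⊆π , σ≅τ) π⊆ρ = τ , ⊆-trans τ⊆π π⊆ρ , σ≅τ

StrictlyMonotoneOn : List ℕ → (ℕ → ℕ) → Set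
StrictlyMonotoneOn xs f = ∀ {x y} → x ∈ xs → y ∈ xs → x < y → f x < f y

≅-map : ∀ xs {f} → StrictlyMonotoneOn xs f → xs ≅ map f xs
≅-map []       mono = []
≅-map (x ∷ xs) {f} mono = agreeing xs there ∷ ≅-map xs (λ p q → mono (there p) (there q))
  where
  reflects : ∀ {u v} → u ∈ x ∷ xs → v ∈ x ∷ xs → f u < f v → u < v
  reflects {u} {v} p q fu<fv with <-cmp u v
  ... | tri< u<v _ _ = u<v
  ... | tri≈ _ refl _ = ⊥-elim (<-irrefl refl fu<fv)
  ... | tri> _ _ v<u = ⊥-elim (<-asym fu<fv (mono q p v<u))
  agreeing : ∀ ys → (∀ {y} → y ∈ ys → y ∈ x ∷ xs) → Pointwise (Agree x (f x)) ys (map f ys)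
  agreeing []       _   = []
  agreeing (y ∷ ys) sub =
    (mk⇔ (mono (here refl) (sub (here refl))) (reflects (here refl) (sub (here refl))) ,
     mk⇔ (mono (sub (here refl)) (here refl)) (reflects (sub (here refl)) (here refl)))
    ∷ agreeing ys (sub ∘ there)

≅-split : ∀ A {B ρ} → ρ ≅ A ++ B → (∀ {a b} → a ∈ A → b ∈ B → a < b) →
  ∃[ ρA ] ∃[ ρB ] ρ ≡ ρA ++ ρB × ρA ≅ A × ρB ≅ B × (∀ {x y} → x ∈ ρA → y ∈ ρB → x < y)
≅-split []      o _   = [] , _ , refl , [] , o , λ ()
≅-split (a ∷ A) (_∷_ {x = x} p o) A<B with ≅-split A o (A<B ∘ there)
... | ρA , ρB , refl , oA , oB , ρA<ρB with Pointwise-++⁻ (≅-length oA) p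
...   | pA , pB = x ∷ ρA , ρB , refl , pA ∷ oA , oB , cross
  where
  x<ρB : All (x <_) ρB
  x<ρB = All-pullback (λ agree → Equivalence.from (proj₁ agree)) pB (All.tabulate (A<B (here refl)))
  cross : ∀ {x′ y} → x′ ∈ x ∷ ρA → y ∈ ρB → x′ < y
  cross (here refl) = All.lookup x<ρB
  cross (there x′∈) = ρA<ρB x′∈

p321 : List ℕ
p321 = 3 ∷ 2 ∷ 1 ∷ []

p25134 : List ℕ
p25134 = 2 ∷ 5 ∷ 1 ∷ 3 ∷ 4 ∷ []

Has321 : List ℕ → Set
Has321 τ = ∃[ a ] ∃[ b ] ∃[ c ] (a ∷ b ∷ c ∷ []) ⊆ τ × b < a × c < b

-- Of an occurrence y x a b c of 25134 only the facts that x exceeds a, b and c are kept.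
Has25134 : List ℕ → Set
Has25134 τ = ∃[ y ] ∃[ x ] ∃[ a ] ∃[ b ] ∃[ c ] (y ∷ x ∷ a ∷ b ∷ c ∷ []) ⊆ τ × a < x × b < x × c < x

321-shape : ∀ {v} → p321 ≅ v → ∃[ a ] ∃[ b ] ∃[ c ] v ≡ a ∷ b ∷ c ∷ [] × b < a × c < b
321-shape ((ab ∷ _ ∷ []) ∷ (bc ∷ []) ∷ [] ∷ []) =
  _ , _ , _ , refl , descent ab (<ᵇ⇒< 2 3 _) , descent bc (<ᵇ⇒< 1 2 _)

25134-shape : ∀ {v} → p25134 ≅ v →
  ∃[ y ] ∃[ x ] ∃[ a ] ∃[ b ] ∃[ c ] v ≡ y ∷ x ∷ a ∷ b ∷ c ∷ [] × a < y × a < x × b < x × c < x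
25134-shape ((_ ∷ ya ∷ _ ∷ _ ∷ []) ∷ (xa ∷ xb ∷ xc ∷ []) ∷ _ ∷ _ ∷ _ ∷ []) =
  _ , _ , _ , _ , _ , refl , descent ya (<ᵇ⇒< 1 2 _) ,
  descent xa (<ᵇ⇒< 1 5 _) , descent xb (<ᵇ⇒< 3 5 _) , descent xc (<ᵇ⇒< 4 5 _)

≼321⇒Has321 : ∀ {τ} → p321 ≼ τ → Has321 τ
≼321⇒Has321 (v , v⊆τ , o) with 321-shape (OrdIso⇒≅ o)
... | a , b , c , refl , b<a , c<b = a , b , c , v⊆τ , b<a , c<b

≼25134⇒Has25134 : ∀ {τ} → p25134 ≼ τ → Has25134 τ
≼25134⇒Has25134 (v , v⊆τ , o) with 25134-shape (OrdIso⇒≅ o)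
... | y , x , a , b , c , refl , _ , a<x , b<x , c<x = y , x , a , b , c , v⊆τ , a<x , b<x , c<x

[1‥_] : ℕ → List ℕ
[1‥ n ] = map suc (upTo n)

∈[1‥]⁻ : ∀ {n} → x ∈ [1‥ n ] → 1 ≤ x × x ≤ n
∈[1‥]⁻ x∈ with i , i∈ , refl ← ∈-map⁻ suc x∈ = s≤s z≤n , ∈-upTo⁻ i∈

∈[1‥]⁺ : ∀ {n} → 1 ≤ x → x ≤ n → x ∈ [1‥ n ]
∈[1‥]⁺ {suc x} _ x≤n = ∈-map⁺ suc (∈-upTo⁺ x≤n)

length-[1‥] : ∀ n → length [1‥ n ] ≡ n
length-[1‥] n = trans (length-map suc (upTo n)) (length-upTo n)

Perm-bounds : ∀ {π} → Perm π → x ∈ π → 1 ≤ x × x ≤ length π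
Perm-bounds π↭ x∈π = ∈[1‥]⁻ (∈-resp-↭ π↭ x∈π)

Perm-complete : ∀ {π} → Perm π → 1 ≤ x → x ≤ length π → x ∈ π
Perm-complete π↭ 1≤x x≤n = ∈-resp-↭ (↭-sym π↭) (∈[1‥]⁺ 1≤x x≤n)

Perm⇒Unique : ∀ {π} → Perm π → Unique π
Perm⇒Unique {π} π↭ =
  PermSetoid.Unique-resp-↭ (setoid ℕ) (↭⇒↭ₛ (↭-sym π↭)) (Unique.map⁺ suc-injective (Unique.upTo⁺ (length π)))

Perm-singleton : ∀ {x} → Perm (x ∷ []) → x ≡ 1
Perm-singleton x↭ with Perm-bounds x↭ (here refl)
... | 1≤x , x≤1 = ≤-antisym x≤1 1≤x

unique-length-mono : Unique xs → (∀ {z} → z ∈ xs → z ∈ ys) → length xs ≤ length ys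
unique-length-mono {[]}     _            _   = z≤n
unique-length-mono {x ∷ xs} (x∉xs ∷ u) sub with p , q , refl ← ∈-∃++ (sub (here refl)) =
  subst (suc (length xs) ≤_) (sym (↭-length (shift x p q))) (s≤s (unique-length-mono u sub′))
  where
  sub′ : ∀ {z} → z ∈ xs → z ∈ p ++ q
  sub′ z∈xs with ∈-resp-↭ (shift x p q) (sub (there z∈xs))
  ... | here refl = ⊥-elim (All.lookup x∉xs z∈xs refl)
  ... | there z∈  = z∈

Unique-bounded⇒Perm : ∀ {π} → Unique π → (∀ {x} → x ∈ π → 1 ≤ x × x ≤ length π) → Perm π
Unique-bounded⇒Perm {π} u bounded =
  ∼bag⇒↭ (unique∧set⇒bag u (Unique.map⁺ suc-injective (Unique.upTo⁺ n)) (mk⇔ to from))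
  where
  n = length π
  to : x ∈ π → x ∈ [1‥ n ]
  to x∈π = ∈[1‥]⁺ (proj₁ (bounded x∈π)) (proj₂ (bounded x∈π))
  from : x ∈ [1‥ n ] → x ∈ π
  from {x} x∈ with x ∈? π
  ... | yes x∈π = x∈π
  ... | no  x∉π = ⊥-elim (1+n≰n (subst (suc n ≤_) (length-[1‥] n) (unique-length-mono x∷π-unique sub)))
    where
    x∷π-unique : Unique (x ∷ π)
    x∷π-unique = All.tabulate (λ z∈π x≡z → x∉π (subst (_∈ π) (sym x≡z) z∈π)) ∷ u
    sub : ∀ {z} → z ∈ x ∷ π → z ∈ [1‥ n ]
    sub (here refl) = x∈
    sub (there z∈π) = to z∈π

shifted-Perm-convex : ∀ {o α u v y} → Perm α → u ∈ map (o +_) α → v ∈ map (o +_) α → u < y → y < v →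
                      y ∈ map (o +_) α
shifted-Perm-convex {o} {α} {y = y} α↭ u∈ v∈ u<y y<v
  with a , a∈ , refl ← ∈-map⁻ (o +_) u∈ | b , b∈ , refl ← ∈-map⁻ (o +_) v∈ =
  subst (_∈ map (o +_) α) (m+[n∸m]≡n (<⇒≤ o<y)) (∈-map⁺ (o +_) (Perm-complete α↭ (m<n⇒0<n∸m o<y) y∸o≤α))
  where
  o<y : o < y
  o<y = <-trans (m<m+n o (proj₁ (Perm-bounds α↭ a∈))) u<y
  y∸o≤α : y ∸ o ≤ length α
  y∸o≤α = ≤-trans (<⇒≤ (+-cancelˡ-< o (y ∸ o) b (subst (_< o + b) (sym (m+[n∸m]≡n (<⇒≤ o<y))) y<v)))
                  (proj₂ (Perm-bounds α↭ b∈))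

countBelow : ℕ → List ℕ → ℕ
countBelow x ts = sum (map (λ t → if t <ᵇ x then 1 else 0) ts)

countBelow-↭ : ∀ x → xs ↭ ys → countBelow x xs ≡ countBelow x ys
countBelow-↭ x p = sum-↭ (↭.map⁺ _ p)

countBelow-zero : ∀ xs → countBelow 0 xs ≡ 0
countBelow-zero []       = refl
countBelow-zero (_ ∷ xs) = countBelow-zero xs

countBelow-suc : ∀ x xs → countBelow (suc x) (map suc xs) ≡ countBelow x xs
countBelow-suc x []       = refl
countBelow-suc x (t ∷ xs) = cong (_ +_) (countBelow-suc x xs)

countBelow-upTo : ∀ {x} n → x ≤ n → countBelow x (upTo n) ≡ x
countBelow-upTo {zero}  n       _         = countBelow-zero (upTo n)
countBelow-upTo {suc x} (suc n) (s≤s x≤n) = cong suc (begin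
  countBelow (suc x) (applyUpTo suc n)    ≡⟨ cong (countBelow (suc x)) (sym (map-upTo suc n)) ⟩
  countBelow (suc x) (map suc (upTo n))   ≡⟨ countBelow-suc x (upTo n) ⟩
  countBelow x (upTo n)                   ≡⟨ countBelow-upTo n x≤n ⟩
  x                                       ∎)
  where open ≡-Reasoning

countBelow-Perm : ∀ {π} → Perm π → x ∈ π → countBelow x π ≡ pred x
countBelow-Perm {π = π} π↭ x∈π with Perm-bounds π↭ x∈π
... | s≤s {n = x} _ , x<n = begin
  countBelow (suc x) π                    ≡⟨ countBelow-↭ (suc x) π↭ ⟩
  countBelow (suc x) [1‥ length π ]       ≡⟨ countBelow-suc x (upTo (length π)) ⟩
  countBelow x (upTo (length π))          ≡⟨ countBelow-upTo (length π) (<⇒≤ x<n) ⟩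
  x                                       ∎
  where open ≡-Reasoning

countBelow-Agree : Pointwise (Agree x y) xs ys → countBelow x xs ≡ countBelow y ys
countBelow-Agree []          = refl
countBelow-Agree (agree ∷ p) =
  cong₂ _+_ (cong (λ b → if b then 1 else 0) (<ᵇ-cong (proj₂ agree))) (countBelow-Agree p)

≅⇒countBelow : xs ≅ ys → Pointwise (λ x y → countBelow x xs ≡ countBelow y ys) xs ys
≅⇒countBelow []                      = []
≅⇒countBelow {x ∷ xs} {y ∷ ys} (p ∷ o) =
  cong₂ _+_ (cong (λ b → if b then 1 else 0) (<ᵇ-cong irrefl)) (countBelow-Agree p) ∷ step p (≅⇒countBelow o)
  where
  irrefl : x < x ⇔ y < y
  irrefl = mk⇔ (⊥-elim ∘ <-irrefl refl) (⊥-elim ∘ <-irrefl refl)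
  step : ∀ {xs′ ys′} → Pointwise (Agree x y) xs′ ys′ →
         Pointwise (λ x′ y′ → countBelow x′ xs ≡ countBelow y′ ys) xs′ ys′ →
         Pointwise (λ x′ y′ → countBelow x′ (x ∷ xs) ≡ countBelow y′ (y ∷ ys)) xs′ ys′
  step []          []          = []
  step (agree ∷ p) (eq ∷ eqs) = cong₂ _+_ (cong (λ b → if b then 1 else 0) (<ᵇ-cong (proj₁ agree))) eq ∷ step p eqs

≅-Perm⇒≡ : ∀ {π ρ} → Perm π → Perm ρ → π ≅ ρ → π ≡ ρ
≅-Perm⇒≡ {π} {ρ} π↭ ρ↭ o = PW.Pointwise-≡⇒≡ (go (≅⇒countBelow o) (All.tabulate id) (All.tabulate id))
  where
  same : countBelow x π ≡ countBelow y ρ → x ∈ π → y ∈ ρ → x ≡ y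
  same eq x∈π y∈ρ with Perm-bounds π↭ x∈π | Perm-bounds ρ↭ y∈ρ
  ... | s≤s _ , _ | s≤s _ , _ = cong suc (trans (sym (countBelow-Perm π↭ x∈π)) (trans eq (countBelow-Perm ρ↭ y∈ρ)))
  go : Pointwise (λ x y → countBelow x π ≡ countBelow y ρ) xs ys → All (_∈ π) xs → All (_∈ ρ) ys →
       Pointwise _≡_ xs ys
  go []         []           []           = []
  go (eq ∷ eqs) (x∈π ∷ x∈s) (y∈ρ ∷ y∈s) = same eq x∈π y∈ρ ∷ go eqs x∈s y∈s

Perm-1⊕ : ∀ {β} → Perm β → Perm (1 ∷ map suc β)
Perm-1⊕ {β} β↭ = prep 1 (↭.map⁺ suc (subst (β ↭_) [1‥]≡ β↭))
  where
  [1‥]≡ : [1‥ length β ] ≡ applyUpTo suc (length (map suc β))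
  [1‥]≡ = trans (map-upTo suc (length β)) (cong (applyUpTo suc) (sym (length-map suc β)))

module DirectSum {A B : List ℕ} (AB↭ : Perm (A ++ B)) (A<B : ∀ {x y} → x ∈ A → y ∈ B → x < y) where

  private
    a = length A

  unique-A : Unique A
  unique-A = AllPairs-resp-⊆ (++⁺ʳ B ⊆-refl) (Perm⇒Unique AB↭)

  A-bounded : x ∈ A → x ≤ a
  A-bounded {x} x∈A = subst (_≤ a) (length-[1‥] x) (unique-length-mono (Unique.map⁺ suc-injective (Unique.upTo⁺ x)) sub)
    where
    sub : z ∈ [1‥ x ] → z ∈ A
    sub z∈ with ∈[1‥]⁻ z∈
    ... | 1≤z , z≤x with ∈-++⁻ A (Perm-complete AB↭ 1≤z (≤-trans z≤x (proj₂ (Perm-bounds AB↭ (∈-++⁺ˡ x∈A)))))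
    ...   | inj₁ z∈A = z∈A
    ...   | inj₂ z∈B = ⊥-elim (<⇒≱ (A<B x∈A z∈B) z≤x)

  B-above : y ∈ B → a < y
  B-above {y} y∈B with Perm-bounds AB↭ (∈-++⁺ʳ A y∈B)
  ... | s≤s {n = y′} _ , _ =
    s≤s (subst (a ≤_) (length-[1‥] y′) (unique-length-mono unique-A sub))
    where
    sub : z ∈ A → z ∈ [1‥ y′ ]
    sub z∈A = ∈[1‥]⁺ (proj₁ (Perm-bounds AB↭ (∈-++⁺ˡ z∈A))) (≤-pred (A<B z∈A y∈B))

  B-unshifted : map (a +_) (map (_∸ a) B) ≡ B
  B-unshifted = trans (sym (map-∘ B)) (map-id-local (All.tabulate (m+[n∸m]≡n ∘ <⇒≤ ∘ B-above)))

  Perm-A : Perm A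
  Perm-A = Unique-bounded⇒Perm unique-A
    (λ x∈A → proj₁ (Perm-bounds AB↭ (∈-++⁺ˡ x∈A)) , A-bounded x∈A)

  Perm-B-shifted : Perm (map (_∸ a) B)
  Perm-B-shifted = Unique-bounded⇒Perm unique bounded
    where
    unique : Unique (map (_∸ a) B)
    unique = Unique.map⁻ (subst Unique (sym B-unshifted) (AllPairs-resp-⊆ (++⁺ˡ A ⊆-refl) (Perm⇒Unique AB↭)))
    bounded : x ∈ map (_∸ a) B → 1 ≤ x × x ≤ length (map (_∸ a) B)
    bounded x∈ with y , y∈B , refl ← ∈-map⁻ (_∸ a) x∈ =
      m<n⇒0<n∸m (B-above y∈B) ,
      subst (y ∸ a ≤_) (trans (m+n∸m≡n a (length B)) (sym (length-map (_∸ a) B)))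
        (∸-monoˡ-≤ a (subst (y ≤_) (length-++ A) (proj₂ (Perm-bounds AB↭ (∈-++⁺ʳ A y∈B)))))

-- Inflations

Av321 : List ℕ → Set
Av321 = Av (p321 ∷ [])

Av25134 : List ℕ → Set
Av25134 = Av (p25134 ∷ [])

𝒞 : List ℕ → Set
𝒞 = Wreath Av25134 Av321

≼-length : ∀ {σ π} → σ ≼ π → length σ ≤ length π
≼-length {π = π} (τ , τ⊆π , o) = subst (_≤ length π) (sym (≅-length (OrdIso⇒≅ o))) (length-mono-≤ τ⊆π)

[1]∈Av321 : Av321 (1 ∷ [])
[1]∈Av321 = ↭-refl , (λ occ → 3≰1 (≼-length occ)) ∷ []
  where
  3≰1 : ¬ 3 ≤ 1
  3≰1 (s≤s ())

Block : List ℕ → Set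
Block α = 0 < length α × Av321 α

singletons : List ℕ → List (List ℕ)
singletons σ = replicate (length σ) (1 ∷ [])

All-singletons : ∀ σ → All Block (singletons σ)
All-singletons []      = []
All-singletons (_ ∷ σ) = (s≤s z≤n , [1]∈Av321) ∷ All-singletons σ

offset-singletons : ∀ σ s → offset σ (singletons σ) s ≡ countBelow s σ
offset-singletons []      s = refl
offset-singletons (t ∷ σ) s = cong (_ +_) (offset-singletons σ s)

indicator-mono : ∀ t n {s s′} → s ≤ s′ → (if t <ᵇ s then n else 0) ≤ (if t <ᵇ s′ then n else 0)
indicator-mono t n {s} {s′} s≤s′ with t <ᵇ s in t<ᵇs
... | false = z≤n
... | true  rewrite <⇒<ᵇ≡true (<-≤-trans (<ᵇ⇒< t s (subst Bool.T (sym t<ᵇs) tt)) s≤s′) = ≤-refl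

offset-mono-≤ : ∀ σ αs {s s′} → s ≤ s′ → offset σ αs s ≤ offset σ αs s′
offset-mono-≤ []      _        _     = z≤n
offset-mono-≤ (_ ∷ _) []       _     = z≤n
offset-mono-≤ (t ∷ σ) (α ∷ αs) s≤s′ = +-mono-≤ (indicator-mono t (length α) s≤s′) (offset-mono-≤ σ αs s≤s′)

offset-mono-< : ∀ σ αs {s s′} → All (λ α → 0 < length α) αs → length αs ≡ length σ →
                s ∈ σ → s < s′ → offset σ αs s < offset σ αs s′
offset-mono-< (t ∷ σ) (α ∷ αs) {s′ = s′} (0<α ∷ _) _ (here refl) t<s′
  rewrite <ᵇ-irrefl t | <⇒<ᵇ≡true t<s′ = +-mono-<-≤ 0<α (offset-mono-≤ σ αs (<⇒≤ t<s′))
offset-mono-< (t ∷ σ) (α ∷ αs) (_ ∷ nonempty) eq (there s∈σ) s<s′ =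
  +-mono-≤-< (indicator-mono t (length α) (<⇒≤ s<s′)) (offset-mono-< σ αs nonempty (suc-injective eq) s∈σ s<s′)

concat-singleton-blocks : ∀ (h : ℕ → ℕ) σ →
  concat (zipWith (λ s α → map (h s +_) α) σ (singletons σ)) ≡ map (λ s → h s + 1) σ
concat-singleton-blocks h []      = refl
concat-singleton-blocks h (s ∷ σ) = cong (h s + 1 ∷_) (concat-singleton-blocks h σ)

inflate-singletons : ∀ {σ} → Perm σ → inflate σ (singletons σ) ≡ σ
inflate-singletons {σ} σ↭ =
  trans (concat-singleton-blocks (offset σ (singletons σ)) σ) (map-id-local (All.tabulate offset+1≡))
  where
  offset+1≡ : ∀ {s} → s ∈ σ → offset σ (singletons σ) s + 1 ≡ s
  offset+1≡ {s} s∈σ with Perm-bounds σ↭ s∈σ | countBelow-Perm σ↭ s∈σ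
  ... | s≤s {n = r} _ , _ | below = trans (cong (_+ 1) (trans (offset-singletons σ s) below)) (+-comm r 1)

inflate-single : ∀ s α → inflate (s ∷ []) (α ∷ []) ≡ α
inflate-single s α rewrite <ᵇ-irrefl s = trans (++-identityʳ _) (map-id α)

inflate-1⊕ : ∀ α β → Perm β → inflate (1 ∷ map suc β) (α ∷ singletons (map suc β)) ≡ α ++ map (length α +_) β
inflate-1⊕ α β β↭ = begin
  map (h 1 +_) α ++ concat (zipWith (λ s α → map (h s +_) α) (map suc β) (singletons (map suc β)))
    ≡⟨ cong₂ _++_ (cong (λ c → map (c +_) α) h1≡0) (concat-singleton-blocks h (map suc β)) ⟩
  map (0 +_) α ++ map (λ s → h s + 1) (map suc β)
    ≡⟨ cong₂ _++_ (map-id α) (trans (sym (map-∘ β)) (map-cong-local (All.tabulate h-suc))) ⟩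
  α ++ map (length α +_) β
    ∎
  where
  open ≡-Reasoning
  h : ℕ → ℕ
  h = offset (1 ∷ map suc β) (α ∷ singletons (map suc β))
  h≡ : ∀ s → h s ≡ (if 1 <ᵇ s then length α else 0) + countBelow s (map suc β)
  h≡ s = cong (_ +_) (offset-singletons (map suc β) s)
  h1≡0 : h 1 ≡ 0
  h1≡0 = trans (h≡ 1) (trans (countBelow-suc 0 β) (countBelow-zero β))
  h-suc : ∀ {b} → b ∈ β → h (suc b) + 1 ≡ length α + b
  h-suc {b} b∈β with Perm-bounds β↭ b∈β
  ... | s≤s {n = b′} _ , _ = begin
    h (suc (suc b′)) + 1                       ≡⟨ cong (_+ 1) (h≡ (suc (suc b′))) ⟩
    length α + countBelow (suc (suc b′)) (map suc β) + 1
      ≡⟨ cong (λ c → length α + c + 1) (trans (countBelow-suc (suc b′) β) (countBelow-Perm β↭ b∈β)) ⟩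
    length α + b′ + 1                          ≡⟨ +-assoc (length α) b′ 1 ⟩
    length α + (b′ + 1)                        ≡⟨ cong (length α +_) (+-comm b′ 1) ⟩
    length α + suc b′                          ∎

Av25134⇒𝒞 : ∀ {ρ} → Av25134 ρ → 𝒞 ρ
Av25134⇒𝒞 {ρ} ρ∈Av@(ρ↭ , _) =
  ρ , singletons ρ , ρ∈Av , length-replicate (length ρ) , All-singletons ρ , sym (inflate-singletons ρ↭)

1⊕-avoids-25134 : ∀ {β} → ¬ (p25134 ≼ β) → ¬ (p25134 ≼ (1 ∷ map suc β))
1⊕-avoids-25134 {β} β-avoids (t , _ ∷ʳ t⊆ , o) =
  β-avoids (≼-respʳ-≅ (t , t⊆ , o) (≅-sym (≅-map β (λ _ _ → s≤s))))
1⊕-avoids-25134 {β} β-avoids (t , refl ∷ t⊆ , o) with 25134-shape (OrdIso⇒≅ o)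
... | _ , _ , a , _ , _ , refl , a<1 , _ with ∈-map⁻ suc (Any-resp-⊆ t⊆ (there (here refl)))
...   | _ , _ , refl with a<1
...     | s≤s ()

⊕∈𝒞 : ∀ {A B} → Perm (A ++ B) → 0 < length A → (∀ {x y} → x ∈ A → y ∈ B → x < y) →
      ¬ (p321 ≼ A) → ¬ (p25134 ≼ B) → 𝒞 (A ++ B)
⊕∈𝒞 {A} {B} AB↭ A≢[] A<B A-avoids B-avoids =
  1 ∷ map suc β , A ∷ singletons (map suc β) ,
  (Perm-1⊕ Perm-B-shifted , 1⊕-avoids-25134 β-avoids ∷ []) ,
  cong suc (length-replicate (length (map suc β))) ,
  (A≢[] , Perm-A , A-avoids ∷ []) ∷ All-singletons (map suc β) ,
  sym (trans (inflate-1⊕ A β Perm-B-shifted) (cong (A ++_) B-unshifted))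
  where
  open DirectSum AB↭ A<B
  β = map (_∸ length A) B
  β-avoids : ¬ (p25134 ≼ β)
  β-avoids occ = B-avoids (≼-respʳ-≅ occ (≅-sym (≅-map B shift-mono)))
    where
    shift-mono : StrictlyMonotoneOn B (_∸ length A)
    shift-mono y∈B _ y<y′ = ∸-monoˡ-< y<y′ (<⇒≤ (B-above y∈B))

record SumSplit (τ : List ℕ) : Set where
  field
    lower upper    : List ℕ
    split          : τ ≡ lower ++ upper
    lower<upper    : ∀ {x y} → x ∈ lower → y ∈ upper → x < y
    lower-no-321   : ¬ Has321 lower
    upper-no-25134 : ¬ Has25134 upper

upper-SumSplit : ∀ {τ} → ¬ Has25134 τ → SumSplit τ
upper-SumSplit {τ} no-25134 = record
  { lower = [] ; upper = τ ; split = refl ; lower<upper = λ ()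
  ; lower-no-321 = λ { (_ , _ , _ , () , _) } ; upper-no-25134 = no-25134 }

lower-SumSplit : ∀ {τ} → ¬ Has321 τ → SumSplit τ
lower-SumSplit {τ} no-321 = record
  { lower = τ ; upper = [] ; split = sym (++-identityʳ τ) ; lower<upper = λ _ ()
  ; lower-no-321 = no-321 ; upper-no-25134 = λ { (_ , _ , _ , _ , _ , () , _) } }

SumSplit⇒𝒞 : ∀ {ρ τ} → Perm ρ → ρ ≅ τ → SumSplit τ → 𝒞 ρ
SumSplit⇒𝒞 ρ↭ o record { lower = [] ; split = refl ; upper-no-25134 = no-25134 } =
  Av25134⇒𝒞 (ρ↭ , (λ occ → no-25134 (≼25134⇒Has25134 (≼-respʳ-≅ occ o))) ∷ [])
SumSplit⇒𝒞 ρ↭ o record { lower = l ∷ L ; split = refl ; lower<upper = L<U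
                         ; lower-no-321 = no-321 ; upper-no-25134 = no-25134 }
  with ≅-split (l ∷ L) o L<U
... | ρA , ρB , refl , oA , oB , ρA<ρB =
  ⊕∈𝒞 ρ↭ (subst (0 <_) (sym (≅-length oA)) (s≤s z≤n)) ρA<ρB
      (λ occ → no-321 (≼321⇒Has321 (≼-respʳ-≅ occ oA)))
      (λ occ → no-25134 (≼25134⇒Has25134 (≼-respʳ-≅ occ oB)))

-- The permutations π m

data Pos : Set where
  F0 F1 F2 F3 : Pos
  T B         : ℕ → Pos
  E0 E1 E2    : Pos

double : ℕ → ℕ
double zero    = zero
double (suc n) = suc (suc (double n))

value : ℕ → Pos → ℕ
value m F0    = 2
value m F1    = 5
value m F2    = 1
value m F3    = 3
value m (T j) = 7 + double j
value m (B j) = 4 + double j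
value m E0    = 7 + double m
value m E1    = 6 + double m
value m E2    = 4 + double m

oscillation : ℕ → ℕ → List Pos
oscillation j zero    = []
oscillation j (suc r) = T j ∷ B j ∷ oscillation (suc j) r

ends : List Pos
ends = E0 ∷ E1 ∷ E2 ∷ []

positions : ℕ → List Pos
positions m = F0 ∷ F1 ∷ F2 ∷ F3 ∷ oscillation 0 m ++ ends

π : ℕ → List ℕ
π m = map (value m) (positions m)

length-π : ∀ m → length (π m) ≡ 7 + double m
length-π m = begin
  length (π m)                                ≡⟨ length-map (value m) (positions m) ⟩
  4 + length (oscillation 0 m ++ ends)        ≡⟨ cong (4 +_) (length-++ (oscillation 0 m)) ⟩
  4 + (length (oscillation 0 m) + 3)          ≡⟨ cong (λ n → 4 + (n + 3)) (length-oscillation 0 m) ⟩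
  4 + (double m + 3)                          ≡⟨ cong (4 +_) (+-comm (double m) 3) ⟩
  7 + double m                                ∎
  where
  open ≡-Reasoning
  length-oscillation : ∀ j r → length (oscillation j r) ≡ double r
  length-oscillation j zero    = refl
  length-oscillation j (suc r) = cong (suc ∘ suc) (length-oscillation (suc j) r)

Valid : ℕ → Pos → Set
Valid m (T j) = j < m
Valid m (B j) = j < m
Valid m _     = ⊤

oscillation-below : ∀ {P : Pos → Set} {c} → (∀ {i} → i < c → P (T i)) → (∀ {i} → i < c → P (B i)) →
                    ∀ j r → j + r ≤ c → All P (oscillation j r)
oscillation-below PT PB j zero    _ = []
oscillation-below {c = c} PT PB j (suc r) h =
  PT j<c ∷ PB j<c ∷ oscillation-below PT PB (suc j) r (subst (_≤ c) (+-suc j r) h)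
  where
  j<c = <-≤-trans (m<m+n j (s≤s z≤n)) h

positions-valid : ∀ m → All (Valid m) (positions m)
positions-valid m = tt ∷ tt ∷ tt ∷ tt ∷ All.++⁺ (oscillation-below id id 0 m ≤-refl) (tt ∷ tt ∷ tt ∷ [])

stage : Pos → ℕ
stage F0    = 0
stage F1    = 1
stage F2    = 2
stage F3    = 3
stage (T _) = 4
stage (B _) = 4
stage E0    = 5
stage E1    = 6
stage E2    = 7

-- The left-to-right order of positions. Stages are compared by a boolean test, so that a false
-- comparison of two concrete positions reduces to ⊥.
_≺_ : Pos → Pos → Set
T i ≺ T j = i < j
T i ≺ B j = i ≤ j
B i ≺ T j = i < j
B i ≺ B j = i < j
p   ≺ q   = Bool.T (stage p <ᵇ stage q)

Beyond : ℕ → Pos → Set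
Beyond j (T i) = j ≤ i
Beyond j (B i) = j ≤ i
Beyond j E0    = ⊤
Beyond j E1    = ⊤
Beyond j E2    = ⊤
Beyond j _     = ⊥

Beyond-oscillation : ∀ j r → All (Beyond j) (oscillation j r ++ ends)
Beyond-oscillation j zero    = tt ∷ tt ∷ tt ∷ []
Beyond-oscillation j (suc r) = ≤-refl ∷ ≤-refl ∷ All.map weaken (Beyond-oscillation (suc j) r)
  where
  weaken : ∀ {p} → Beyond (suc j) p → Beyond j p
  weaken {T i} j<i = <⇒≤ j<i
  weaken {B i} j<i = <⇒≤ j<i
  weaken {E0}  _   = tt
  weaken {E1}  _   = tt
  weaken {E2}  _   = tt

Beyond⇒T≺ : ∀ {j p} → Beyond (suc j) p → T j ≺ p
Beyond⇒T≺ {p = T i} j<i = j<i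
Beyond⇒T≺ {p = B i} j<i = <⇒≤ j<i
Beyond⇒T≺ {p = E0}  _   = _
Beyond⇒T≺ {p = E1}  _   = _
Beyond⇒T≺ {p = E2}  _   = _

Beyond⇒B≺ : ∀ {j p} → Beyond (suc j) p → B j ≺ p
Beyond⇒B≺ {p = T i} j<i = j<i
Beyond⇒B≺ {p = B i} j<i = j<i
Beyond⇒B≺ {p = E0}  _   = _
Beyond⇒B≺ {p = E1}  _   = _
Beyond⇒B≺ {p = E2}  _   = _

Beyond⇒4≤stage : ∀ {j p} → Beyond j p → 4 ≤ stage p
Beyond⇒4≤stage {p = T i} _ = ≤-refl
Beyond⇒4≤stage {p = B i} _ = ≤-refl
Beyond⇒4≤stage {p = E0}  _ = <ᵇ⇒< 3 5 _
Beyond⇒4≤stage {p = E1}  _ = <ᵇ⇒< 3 6 _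
Beyond⇒4≤stage {p = E2}  _ = <ᵇ⇒< 3 7 _

oscillation-sorted : ∀ j r → AllPairs _≺_ (oscillation j r ++ ends)
oscillation-sorted j zero    = (_ ∷ _ ∷ []) ∷ (_ ∷ []) ∷ [] ∷ []
oscillation-sorted j (suc r) =
  (≤-refl ∷ All.map Beyond⇒T≺ beyond) ∷ All.map Beyond⇒B≺ beyond ∷ oscillation-sorted (suc j) r
  where
  beyond = Beyond-oscillation (suc j) r

positions-sorted : ∀ m → AllPairs _≺_ (positions m)
positions-sorted m =
  (_ ∷ _ ∷ _ ∷ before-oscillation 0) ∷
  (_ ∷ _ ∷ before-oscillation 1) ∷
  (_ ∷ before-oscillation 2) ∷
  before-oscillation 3 ∷
  oscillation-sorted 0 m
  where
  before-oscillation : ∀ k → {Bool.T (k <ᵇ 4)} → All (λ p → Bool.T (k <ᵇ stage p)) (oscillation 0 m ++ ends)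
  before-oscillation k {k<4} = All.map (<⇒<ᵇ ∘ <-≤-trans (<ᵇ⇒< k 4 k<4) ∘ Beyond⇒4≤stage) (Beyond-oscillation 0 m)

double-mono-≤ : i ≤ j → double i ≤ double j
double-mono-≤ z≤n       = z≤n
double-mono-≤ (s≤s i≤j) = s≤s (s≤s (double-mono-≤ i≤j))

double-mono-< : i < j → double i < double j
double-mono-< i<j = ≤-trans (n≤1+n _) (double-mono-≤ i<j)

<+double : ∀ {a c} j → a < c → a < c + double j
<+double j = m≤n⇒m≤n+o (double j)

n≤double : ∀ n → n ≤ double n
n≤double zero    = z≤n
n≤double (suc n) = s≤s (m≤n⇒m≤1+n (n≤double n))

data Inversion (m : ℕ) : Pos → Pos → Set where
  F0-F2 : Inversion m F0 F2
  F1-F2 : Inversion m F1 F2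
  F1-F3 : Inversion m F1 F3
  F1-B0 : Inversion m F1 (B 0)
  T-B   : Inversion m (T j) (B j)
  T-B⁺  : suc j < m → Inversion m (T j) (B (suc j))
  T-E2  : suc j ≡ m → Inversion m (T j) E2
  E0-E1 : Inversion m E0 E1
  E0-E2 : Inversion m E0 E2
  E1-E2 : Inversion m E1 E2

Inversion⇒descent : ∀ {p q} → Inversion m p q → value m q < value m p
Inversion⇒descent F0-F2            = <ᵇ⇒< 1 2 _
Inversion⇒descent F1-F2            = <ᵇ⇒< 1 5 _
Inversion⇒descent F1-F3            = <ᵇ⇒< 3 5 _
Inversion⇒descent F1-B0            = <ᵇ⇒< 4 5 _
Inversion⇒descent (T-B {j = j})    = +-monoˡ-< (double j) (<ᵇ⇒< 4 7 _)
Inversion⇒descent (T-B⁺ _)         = ≤-refl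
Inversion⇒descent (T-E2 refl)      = ≤-refl
Inversion⇒descent E0-E1            = ≤-refl
Inversion⇒descent {m} E0-E2        = +-monoˡ-< (double m) (<ᵇ⇒< 4 7 _)
Inversion⇒descent {m} E1-E2        = +-monoˡ-< (double m) (<ᵇ⇒< 4 6 _)

Classified : ℕ → Pos → Pos → Set
Classified m p q = value m p < value m q ⊎ Inversion m p q

Classified⇒≢ : ∀ {p q} → Classified m p q → value m p ≢ value m q
Classified⇒≢ (inj₁ p<q)  eq = <-irrefl eq p<q
Classified⇒≢ (inj₂ pq)   eq = <-irrefl (sym eq) (Inversion⇒descent pq)

descent⇒Inversion : ∀ {p q} → Classified m p q → value m q < value m p → Inversion m p q
descent⇒Inversion (inj₁ p<q) q<p = ⊥-elim (<-asym p<q q<p)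
descent⇒Inversion (inj₂ pq)  _   = pq

oscillation-lower-bound : ∀ k r → k + r ≤ m → All (λ p → 4 + double k ≤ value m p) (oscillation k r ++ ends)
oscillation-lower-bound {m} k zero h = E0-bound ∷ E1-bound ∷ E2-bound ∷ []
  where
  E2-bound : 4 + double k ≤ 4 + double m
  E2-bound = +-monoʳ-≤ 4 (double-mono-≤ (subst (_≤ m) (+-identityʳ k) h))
  E1-bound = ≤-trans E2-bound (+-monoˡ-≤ (double m) (<ᵇ⇒< 3 6 _))
  E0-bound = ≤-trans E2-bound (+-monoˡ-≤ (double m) (<ᵇ⇒< 3 7 _))
oscillation-lower-bound {m} k (suc r) h =
  +-monoˡ-≤ (double k) (<ᵇ⇒< 3 7 _) ∷ ≤-refl ∷
  All.map (≤-trans (+-monoˡ-≤ (double k) (≤ᵇ⇒≤ 4 6 _)))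
          (oscillation-lower-bound (suc k) r (subst (_≤ m) (+-suc k r) h))

oscillation-classified : ∀ j r → j + r ≡ m → AllPairs (Classified m) (oscillation j r ++ ends)
oscillation-classified j zero    _ = (inj₂ E0-E1 ∷ inj₂ E0-E2 ∷ []) ∷ (inj₂ E1-E2 ∷ []) ∷ [] ∷ []
oscillation-classified {m} j (suc r) h =
  (inj₂ T-B ∷ T-row r h) ∷ B-row ∷ oscillation-classified (suc j) r (trans (sym (+-suc j r)) h)
  where
  above : ∀ k r → k + r ≡ m → ∀ {p} → value m p < 4 + double k → All (Classified m p) (oscillation k r ++ ends)
  above k r k+r≡m p< = All.map (inj₁ ∘ <-≤-trans p<) (oscillation-lower-bound k r (≤-reflexive k+r≡m))
  B-row : All (Classified m (B j)) (oscillation (suc j) r ++ ends)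
  B-row = above (suc j) r (trans (sym (+-suc j r)) h) (+-monoˡ-< (double j) (<ᵇ⇒< 4 6 _))
  T-row : ∀ r → j + suc r ≡ m → All (Classified m (T j)) (oscillation (suc j) r ++ ends)
  T-row zero    h =
    inj₁ (+-monoʳ-< 7 (double-mono-< j<m)) ∷ inj₁ (+-monoʳ-≤ 6 (double-mono-≤ j<m)) ∷ inj₂ (T-E2 sj≡m) ∷ []
    where
    sj≡m : suc j ≡ m
    sj≡m = trans (sym (trans (+-suc j 0) (cong suc (+-identityʳ j)))) h
    j<m : j < m
    j<m = ≤-reflexive sj≡m
  T-row (suc r) h = inj₁ (+-monoʳ-< 7 (double-mono-< (n<1+n j))) ∷ inj₂ (T-B⁺ sj<m) ∷ above (2 + j) r ssj+r≡m ≤-refl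
    where
    ssj+r≡m : 2 + j + r ≡ m
    ssj+r≡m = trans (sym (trans (+-suc j (suc r)) (cong suc (+-suc j r)))) h
    sj<m : suc j < m
    sj<m = ≤-trans (m≤m+n (2 + j) r) (≤-reflexive ssj+r≡m)

positions-classified : ∀ m → 1 ≤ m → AllPairs (Classified m) (positions m)
positions-classified m@(suc m′) _ =
  (inj₁ (<ᵇ⇒< 2 5 _) ∷ inj₂ F0-F2 ∷ inj₁ (<ᵇ⇒< 2 3 _) ∷ below-oscillation (<ᵇ⇒< 2 4 _)) ∷
  (inj₂ F1-F2 ∷ inj₂ F1-F3 ∷ inj₁ (<ᵇ⇒< 5 7 _) ∷ inj₂ F1-B0 ∷ F1-row) ∷
  (inj₁ (<ᵇ⇒< 1 3 _) ∷ below-oscillation (<ᵇ⇒< 1 4 _)) ∷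
  below-oscillation (<ᵇ⇒< 3 4 _) ∷
  oscillation-classified 0 m refl
  where
  below-oscillation : ∀ {p} → value m p < 4 → All (Classified m p) (oscillation 0 m ++ ends)
  below-oscillation p<4 = All.map (inj₁ ∘ <-≤-trans p<4) (oscillation-lower-bound 0 m ≤-refl)
  F1-row : All (Classified m F1) (oscillation 1 m′ ++ ends)
  F1-row = All.map (inj₁ ∘ <-≤-trans (<ᵇ⇒< 5 6 _)) (oscillation-lower-bound 1 m′ ≤-refl)

positions-unique : 1 ≤ m → Unique (positions m)
positions-unique {m} m≥1 = AllPairs.map (λ c p≡q → Classified⇒≢ c (cong (value m) p≡q)) (positions-classified m m≥1)

value-bounds : ∀ {p} → Valid m p → 1 ≤ value m p × value m p ≤ 7 + double m
value-bounds {m} {F0}  _   = s≤s z≤n , <+double m (<ᵇ⇒< 1 7 _)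
value-bounds {m} {F1}  _   = s≤s z≤n , <+double m (<ᵇ⇒< 4 7 _)
value-bounds {m} {F2}  _   = s≤s z≤n , <+double m (<ᵇ⇒< 0 7 _)
value-bounds {m} {F3}  _   = s≤s z≤n , <+double m (<ᵇ⇒< 2 7 _)
value-bounds {m} {T j} j<m = s≤s z≤n , +-monoʳ-≤ 7 (double-mono-≤ (<⇒≤ j<m))
value-bounds {m} {B j} j<m = s≤s z≤n , +-mono-≤ (≤ᵇ⇒≤ 4 7 _) (double-mono-≤ (<⇒≤ j<m))
value-bounds {m} {E0}  _   = s≤s z≤n , ≤-refl
value-bounds {m} {E1}  _   = s≤s z≤n , n≤1+n _
value-bounds {m} {E2}  _   = s≤s z≤n , +-monoˡ-≤ (double m) (≤ᵇ⇒≤ 4 7 _)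

π-Perm : ∀ m → 1 ≤ m → Perm (π m)
π-Perm m m≥1 = Unique-bounded⇒Perm unique bounded
  where
  unique : Unique (π m)
  unique = AllPairs.map⁺ (AllPairs.map Classified⇒≢ (positions-classified m m≥1))
  bounded : ∀ {x} → x ∈ π m → 1 ≤ x × x ≤ length (π m)
  bounded x∈ with p , p∈ , refl ← ∈-map⁻ (value m) x∈ =
    proj₁ (value-bounds valid) , subst (value m p ≤_) (sym (length-π m)) (proj₂ (value-bounds valid))
    where
    valid = All.lookup (positions-valid m) p∈

321≼π : ∀ m → p321 ≼ π m
321≼π m = value m E0 ∷ value m E1 ∷ value m E2 ∷ [] ,
  Sublist.map⁺ (value m) (F0 ∷ʳ F1 ∷ʳ F2 ∷ʳ F3 ∷ʳ ++⁺ˡ (oscillation 0 m) ⊆-refl) ,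
  ≅⇒OrdIso ((Agree-descents (<ᵇ⇒< 2 3 _) ≤-refl ∷ Agree-descents (<ᵇ⇒< 1 3 _) E2<E0 ∷ []) ∷
            (Agree-descents (<ᵇ⇒< 1 2 _) E2<E1 ∷ []) ∷ [] ∷ [])
  where
  E2<E0 = +-monoˡ-< (double m) (<ᵇ⇒< 4 7 _)
  E2<E1 = +-monoˡ-< (double m) (<ᵇ⇒< 4 6 _)

-- Where 321 and 25134 occur in π m

chained-inversions : ∀ {p q r} → Inversion m p q → Inversion m q r → p ≡ E0 × q ≡ E1 × r ≡ E2
chained-inversions E0-E1 E1-E2 = refl , refl , refl

three-later-inversions : ∀ {p q₁ q₂ q₃} → Inversion m p q₁ → Inversion m p q₂ → Inversion m p q₃ →
                         q₁ ≺ q₂ → q₂ ≺ q₃ →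
                         p ≡ F1 × q₁ ≡ F2 × q₂ ≡ F3 × q₃ ≡ B 0
three-later-inversions F1-F2 F1-F3 F1-B0 _ _ = refl , refl , refl , refl
three-later-inversions F0-F2 F0-F2 _ () _
three-later-inversions F1-F2 F1-F2 _ () _
three-later-inversions F1-F2 F1-F3 F1-F2 _ ()
three-later-inversions F1-F2 F1-F3 F1-F3 _ ()
three-later-inversions F1-F2 F1-B0 F1-F2 _ ()
three-later-inversions F1-F2 F1-B0 F1-F3 _ ()
three-later-inversions F1-F2 F1-B0 F1-B0 _ ()
three-later-inversions F1-F3 F1-F2 _ () _
three-later-inversions F1-F3 F1-F3 _ () _
three-later-inversions F1-F3 F1-B0 F1-F2 _ ()
three-later-inversions F1-F3 F1-B0 F1-F3 _ ()
three-later-inversions F1-F3 F1-B0 F1-B0 _ ()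
three-later-inversions F1-B0 F1-F2 _ () _
three-later-inversions F1-B0 F1-F3 _ () _
three-later-inversions F1-B0 F1-B0 _ () _
three-later-inversions T-B T-B _ j<j _ = ⊥-elim (<-irrefl refl j<j)
three-later-inversions T-B (T-B⁺ _) T-B _ j<j = ⊥-elim (<-asym j<j (n<1+n _))
three-later-inversions T-B (T-B⁺ _) (T-B⁺ _) _ j<j = ⊥-elim (<-irrefl refl j<j)
three-later-inversions T-B (T-B⁺ j<m) (T-E2 j≡m) _ _ = ⊥-elim (<-irrefl j≡m j<m)
three-later-inversions T-B (T-E2 _) T-B _ ()
three-later-inversions T-B (T-E2 _) (T-B⁺ _) _ ()
three-later-inversions T-B (T-E2 _) (T-E2 _) _ ()
three-later-inversions (T-B⁺ _) T-B _ j<j _ = ⊥-elim (<-asym j<j (n<1+n _))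
three-later-inversions (T-B⁺ _) (T-B⁺ _) _ j<j _ = ⊥-elim (<-irrefl refl j<j)
three-later-inversions (T-B⁺ j<m) (T-E2 j≡m) _ _ _ = ⊥-elim (<-irrefl j≡m j<m)
three-later-inversions (T-E2 _) T-B _ () _
three-later-inversions (T-E2 _) (T-B⁺ _) _ () _
three-later-inversions (T-E2 _) (T-E2 _) _ () _
three-later-inversions E0-E1 E0-E1 _ () _
three-later-inversions E0-E1 E0-E2 E0-E1 _ ()
three-later-inversions E0-E1 E0-E2 E0-E2 _ ()
three-later-inversions E0-E2 E0-E1 _ () _
three-later-inversions E0-E2 E0-E2 _ () _
three-later-inversions E1-E2 E1-E2 _ () _

before-F1 : ∀ {p} → p ≺ F1 → p ≡ F0
before-F1 {F0} _ = refl
before-F1 {F1} ()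
before-F1 {F2} ()
before-F1 {F3} ()
before-F1 {T _} ()
before-F1 {B _} ()
before-F1 {E0} ()
before-F1 {E1} ()
before-F1 {E2} ()

Ordered : ℕ → Pos → Pos → Set
Ordered m p q = p ≺ q × Classified m p q

sub-positions-ordered : ∀ {qs} → 1 ≤ m → qs ⊆ positions m → AllPairs (Ordered m) qs
sub-positions-ordered {m} m≥1 qs⊆ =
  AllPairs-resp-⊆ qs⊆ (AllPairs.zip (positions-sorted m , positions-classified m m≥1))

Has321⇒E0E1E2 : ∀ {qs} → 1 ≤ m → qs ⊆ positions m → Has321 (map (value m) qs) → All (_∈ qs) (E0 ∷ E1 ∷ E2 ∷ [])
Has321⇒E0E1E2 {m} {qs} m≥1 qs⊆ (_ , _ , _ , abc⊆ , b<a , c<b) with ⊆-map⁻ (value m) qs abc⊆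
... | _ ∷ _ ∷ _ ∷ [] , pqr⊆ , refl
    with ((_ , pq) ∷ _ ∷ []) ∷ ((_ , qr) ∷ []) ∷ [] ∷ [] ← sub-positions-ordered m≥1 (⊆-trans pqr⊆ qs⊆)
    with refl , refl , refl ← chained-inversions (descent⇒Inversion pq b<a) (descent⇒Inversion qr c<b) =
  All.tabulate (Any-resp-⊆ pqr⊆)

Has25134⇒F0F1F2F3B0 : ∀ {qs} → 1 ≤ m → qs ⊆ positions m → Has25134 (map (value m) qs) →
                      All (_∈ qs) (F0 ∷ F1 ∷ F2 ∷ F3 ∷ B 0 ∷ [])
Has25134⇒F0F1F2F3B0 {m} {qs} m≥1 qs⊆ (_ , _ , _ , _ , _ , yxabc⊆ , a<x , b<x , c<x) with ⊆-map⁻ (value m) qs yxabc⊆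
... | p₀ ∷ _ ∷ _ ∷ _ ∷ _ ∷ [] , ps⊆ , refl
    with ((yx , _) ∷ _) ∷ ((_ , xa) ∷ (_ , xb) ∷ (_ , xc) ∷ []) ∷ ((ab , _) ∷ _) ∷ ((bc , _) ∷ []) ∷ [] ∷ []
         ← sub-positions-ordered m≥1 (⊆-trans ps⊆ qs⊆)
    with refl , refl , refl , refl
           ← three-later-inversions (descent⇒Inversion xa a<x) (descent⇒Inversion xb b<x)
                                    (descent⇒Inversion xc c<x) ab bc
    with refl ← before-F1 {p₀} yx =
  All.tabulate (Any-resp-⊆ ps⊆)

-- π m is not in the class

oscillation-prefix-exceeds : ∀ j r {L R} → j + r ≤ m → map (value m) (oscillation j r ++ ends) ≡ L ++ R →
  0 < length L → 0 < length R → ∃[ x ] x ∈ L × length L + (4 + double j) < x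
oscillation-prefix-exceeds {m} j zero {x ∷ L} {R} j+0≤m e _ 0<R = x , here refl , bound L R e 0<R
  where
  E0-bound : ∀ {n} → n ≤ 2 → n + (4 + double j) < 7 + double m
  E0-bound n≤2 = +-mono-≤-< n≤2 (+-monoʳ-≤ 5 (double-mono-≤ (subst (_≤ m) (+-identityʳ j) j+0≤m)))
  bound : ∀ L R → map (value m) ends ≡ x ∷ L ++ R → 0 < length R → length (x ∷ L) + (4 + double j) < x
  bound []          _ e _ = subst (_ <_) (∷-injectiveˡ e) (E0-bound (≤ᵇ⇒≤ 1 2 _))
  bound (_ ∷ [])    _ e _ = subst (_ <_) (∷-injectiveˡ e) (E0-bound ≤-refl)
  bound (_ ∷ _ ∷ L) R e 0<R =
    ⊥-elim (<-irrefl (sym (cong length (++-conicalʳ L R (sym (∷-injectiveʳ (∷-injectiveʳ (∷-injectiveʳ e))))))) 0<R)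
oscillation-prefix-exceeds j (suc r) {x ∷ []} _ e _ _ =
  x , here refl , subst (5 + double j <_) (∷-injectiveˡ e) (+-monoˡ-< (double j) (<ᵇ⇒< 5 7 _))
oscillation-prefix-exceeds j (suc r) {x ∷ _ ∷ []} _ e _ _ =
  x , here refl , subst (6 + double j <_) (∷-injectiveˡ e) (+-monoˡ-< (double j) (<ᵇ⇒< 6 7 _))
oscillation-prefix-exceeds {m} j (suc r) {_ ∷ _ ∷ z ∷ L} j+r≤m e _ 0<R
  with x , x∈ , bound ← oscillation-prefix-exceeds (suc j) r {z ∷ L} (subst (_≤ m) (+-suc j r) j+r≤m)
                                                   (∷-injectiveʳ (∷-injectiveʳ e)) (s≤s z≤n) 0<R =
  x , there (there x∈) , subst (_< x) (reindex (length (z ∷ L))) bound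
  where
  reindex : ∀ n → n + (4 + double (suc j)) ≡ suc (suc n) + (4 + double j)
  reindex n = trans (+-suc n _) (cong suc (+-suc n _))

π-prefix-exceeds : ∀ {L R} → π m ≡ L ++ R → 0 < length L → 0 < length R → ∃[ x ] x ∈ L × length L < x
π-prefix-exceeds {L = x ∷ []} e _ _ = x , here refl , subst (1 <_) (∷-injectiveˡ e) (<ᵇ⇒< 1 2 _)
π-prefix-exceeds {L = _ ∷ y ∷ []} e _ _ =
  y , there (here refl) , subst (2 <_) (∷-injectiveˡ (∷-injectiveʳ e)) (<ᵇ⇒< 2 5 _)
π-prefix-exceeds {L = _ ∷ y ∷ _ ∷ []} e _ _ =
  y , there (here refl) , subst (3 <_) (∷-injectiveˡ (∷-injectiveʳ e)) (<ᵇ⇒< 3 5 _)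
π-prefix-exceeds {L = _ ∷ y ∷ _ ∷ _ ∷ []} e _ _ =
  y , there (here refl) , subst (4 <_) (∷-injectiveˡ (∷-injectiveʳ e)) (<ᵇ⇒< 4 5 _)
π-prefix-exceeds {m} {L = _ ∷ _ ∷ _ ∷ _ ∷ v ∷ L} e _ 0<R
  with x , x∈ , bound ← oscillation-prefix-exceeds 0 m {v ∷ L} ≤-refl
                          (∷-injectiveʳ (∷-injectiveʳ (∷-injectiveʳ (∷-injectiveʳ e)))) (s≤s z≤n) 0<R =
  x , there (there (there (there x∈))) , subst (_< x) (+-comm (length (v ∷ L)) 4) bound

prefix-not-Perm : ∀ {L R} → π m ≡ L ++ R → 0 < length L → 0 < length R → ¬ Perm L
prefix-not-Perm e 0<L 0<R L↭ with x , x∈ , L<x ← π-prefix-exceeds e 0<L 0<R =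
  <⇒≱ L<x (proj₂ (Perm-bounds L↭ x∈))

Between : ℕ → ℕ → ℕ → Set
Between a y b = (a < y × y < b) ⊎ (b < y × y < a)

module Blocks (h : ℕ → ℕ) where

  block : ℕ → List ℕ → List ℕ
  block s α = map (h s +_) α

  blocks : List ℕ → List (List ℕ) → List ℕ
  blocks σr αr = concat (zipWith block σr αr)

  -- A block holds an interval of values, so two adjacent entries with a value between them
  -- that occurs outside the remaining blocks cannot share a block.
  peel : ∀ {σr αr a b rest y} → blocks σr αr ≡ a ∷ b ∷ rest → All Block αr →
         y ∉ a ∷ b ∷ rest → Between a y b →
         ∃[ s ] ∃[ σr′ ] ∃[ αr′ ] σr ≡ s ∷ σr′ × αr ≡ (1 ∷ []) ∷ αr′ × h s + 1 ≡ a ×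
                                  blocks σr′ αr′ ≡ b ∷ rest × All Block αr′
  peel {[]}     {_}                    ()
  peel {_ ∷ _}  {[]}                   ()
  peel {_ ∷ _}  {[] ∷ _}               _ ((() , _) ∷ _)
  peel {s ∷ σr} {(x ∷ []) ∷ αr}        e ((_ , x↭ , _) ∷ ok) _ _ with refl ← Perm-singleton x↭ =
    s , σr , αr , refl , refl , ∷-injectiveˡ e , ∷-injectiveʳ e , ok
  peel {s ∷ σr} {(x ∷ x′ ∷ α) ∷ αr} {y = y} e ((_ , α↭ , _) ∷ _) y∉ between
    with refl , e′ ← ∷-injective e with refl , _ ← ∷-injective e′ =
    ⊥-elim (y∉ (subst (y ∈_) e (∈-++⁺ˡ (y∈block between))))
    where
    y∈block : Between (h s + x) y (h s + x′) → y ∈ block s (x ∷ x′ ∷ α)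
    y∈block (inj₁ (a<y , y<b)) = shifted-Perm-convex α↭ (here refl) (there (here refl)) a<y y<b
    y∈block (inj₂ (b<y , y<a)) = shifted-Perm-convex α↭ (there (here refl)) (here refl) b<y y<a

  -- A first block of two entries cannot hold both 2 and 5; a longer one holds the entry 1, so it
  -- has offset 0 and is a proper prefix of π m that is a permutation.
  first-block-singleton : ∀ {s s′ σr α α′ αr} → blocks (s ∷ s′ ∷ σr) (α ∷ α′ ∷ αr) ≡ π m →
                          All Block (α ∷ α′ ∷ αr) → α ≡ 1 ∷ []
  first-block-singleton {α = []}     _ ((() , _) ∷ _)
  first-block-singleton {α′ = []}    _ (_ ∷ (() , _) ∷ _)
  first-block-singleton {α = x ∷ []} _ ((_ , x↭ , _) ∷ _) = cong (_∷ []) (Perm-singleton x↭)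
  first-block-singleton {s = s} {α = x₁ ∷ x₂ ∷ []} e ((_ , α↭ , _) ∷ _) =
    ⊥-elim (<⇒≱ (<ᵇ⇒< 3 5 _) (subst (_≤ 3) (∷-injectiveˡ (∷-injectiveʳ e)) (+-mono-≤ (≤-pred h<2) x₂≤2)))
    where
    h<2 = subst (h s <_) (∷-injectiveˡ e) (m<m+n (h s) (proj₁ (Perm-bounds α↭ (here refl))))
    x₂≤2 = proj₂ (Perm-bounds α↭ (there (here refl)))
  first-block-singleton {s = s} {s′} {σr} {x₁ ∷ x₂ ∷ x₃ ∷ α} {α′@(_ ∷ _)} {αr} e ((_ , α↭ , _) ∷ _) =
    ⊥-elim (prefix-not-Perm (trans (sym e) (cong (_++ blocks (s′ ∷ σr) (α′ ∷ αr)) block≡))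
                            (s≤s z≤n) (s≤s z≤n) α↭)
    where
    h<1 = subst (h s <_) (∷-injectiveˡ (∷-injectiveʳ (∷-injectiveʳ e)))
                (m<m+n (h s) (proj₁ (Perm-bounds α↭ (there (there (here refl))))))
    block≡ : block s (x₁ ∷ x₂ ∷ x₃ ∷ α) ≡ x₁ ∷ x₂ ∷ x₃ ∷ α
    block≡ = trans (cong (λ o → map (o +_) (x₁ ∷ x₂ ∷ x₃ ∷ α)) (n<1⇒n≡0 h<1)) (map-id _)

-- Each of 5 1 3 7 4 is separated from its successor by the value of an earlier entry (2 2 5 5 7).
leading-singletons : ∀ k (h : ℕ → ℕ) {σ αs} → Blocks.blocks h σ αs ≡ π (2 + k) → 2 ≤ length σ →
  length αs ≡ length σ → All Block αs →
  ∃[ ss ] ss ⊆ σ × map (λ s → h s + 1) ss ≡ 2 ∷ 5 ∷ 1 ∷ 3 ∷ 7 ∷ 4 ∷ []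
leading-singletons k h {[]}          _ ()       _  _
leading-singletons k h {_ ∷ []}      _ (s≤s ()) _  _
leading-singletons k h {_ ∷ _ ∷ _} {[]}     _ _ () _
leading-singletons k h {_ ∷ _ ∷ _} {_ ∷ []} _ _ () _
leading-singletons k h {s₀ ∷ s₁ ∷ σ₂} {_ ∷ _ ∷ _} eq _ _ ok
  with refl ← Blocks.first-block-singleton h {2 + k} {σr = σ₂} eq ok
  with u₂ ∷ u₅ ∷ _ ∷ _ ∷ u₇ ∷ _ ← Perm⇒Unique (π-Perm (2 + k) (s≤s z≤n))
  with _ , _ , _ , refl , refl , o₁ , e₁ , ok₁
         ← Blocks.peel h {s₁ ∷ σ₂} (∷-injectiveʳ eq) (All.tail ok) (All¬⇒¬Any u₂)
                       (inj₂ (<ᵇ⇒< 1 2 _ , <ᵇ⇒< 2 5 _))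
  with s₂ , σ₃ , _ , refl , refl , o₂ , e₂ , ok₂
         ← Blocks.peel h {σ₂} e₁ ok₁ (All¬⇒¬Any (All.tail u₂))
                       (inj₁ (<ᵇ⇒< 1 2 _ , <ᵇ⇒< 2 3 _))
  with s₃ , σ₄ , _ , refl , refl , o₃ , e₃ , ok₃
         ← Blocks.peel h {σ₃} e₂ ok₂ (All¬⇒¬Any (All.tail u₅))
                       (inj₁ (<ᵇ⇒< 3 5 _ , <ᵇ⇒< 5 7 _))
  with s₄ , σ₅ , _ , refl , refl , o₄ , e₄ , ok₄
         ← Blocks.peel h {σ₄} e₃ ok₃ (All¬⇒¬Any (All.tail (All.tail u₅)))
                       (inj₂ (<ᵇ⇒< 4 5 _ , <ᵇ⇒< 5 7 _))
  with s₅ , _ , _ , refl , refl , o₅ , _ , _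
         ← Blocks.peel h {σ₅} e₄ ok₄ (All¬⇒¬Any u₇)
                       (inj₁ (<ᵇ⇒< 4 7 _ , <ᵇ⇒< 7 9 _)) =
  s₀ ∷ s₁ ∷ s₂ ∷ s₃ ∷ s₄ ∷ s₅ ∷ [] , refl ∷ refl ∷ refl ∷ refl ∷ refl ∷ refl ∷ minimum _ ,
  cong₂ _∷_ (∷-injectiveˡ eq) (cong₂ _∷_ o₁ (cong₂ _∷_ o₂ (cong₂ _∷_ o₃ (cong₂ _∷_ o₄ (cong (_∷ []) o₅)))))

skeleton-has-25134 : ∀ {σ αs ss} → All (λ α → 0 < length α) αs → length αs ≡ length σ → ss ⊆ σ →
  map (λ s → offset σ αs s + 1) ss ≡ 2 ∷ 5 ∷ 1 ∷ 3 ∷ 7 ∷ 4 ∷ [] → p25134 ≼ σ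
skeleton-has-25134 {σ} {αs} {ss} nonempty len ss⊆σ eq =
  ≼-respʳ-⊆ (≼-respʳ-≅ 25134≼251374 (≅-sym (subst (ss ≅_) eq (≅-map ss mono)))) ss⊆σ
  where
  mono : StrictlyMonotoneOn ss (λ s → offset σ αs s + 1)
  mono s∈ _ s<s′ = +-monoˡ-< 1 (offset-mono-< σ αs nonempty len (Any-resp-⊆ ss⊆σ s∈) s<s′)
  25134≼251374 : p25134 ≼ (2 ∷ 5 ∷ 1 ∷ 3 ∷ 7 ∷ 4 ∷ [])
  25134≼251374 = p25134 , refl ∷ refl ∷ refl ∷ refl ∷ 7 ∷ʳ refl ∷ [] , ≅⇒OrdIso (≅-refl p25134)

π∉𝒞 : ∀ k → ¬ 𝒞 (π (2 + k))
π∉𝒞 k ([] , _ , _ , _ , _ , ())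
π∉𝒞 k (_ ∷ [] , [] , _ , () , _)
π∉𝒞 k (_ ∷ [] , _ ∷ _ ∷ _ , _ , () , _)
π∉𝒞 k (s ∷ [] , α ∷ [] , _ , _ , (_ , _ , α-avoids ∷ []) ∷ [] , eq) =
  α-avoids (subst (p321 ≼_) (trans eq (inflate-single s α)) (321≼π (2 + k)))
π∉𝒞 k (σ@(_ ∷ _ ∷ _) , αs , (_ , σ-avoids ∷ []) , len , ok , eq)
  with ss , ss⊆σ , offsets ← leading-singletons k (offset σ αs) (sym eq) (s≤s (s≤s z≤n)) len ok =
  σ-avoids (skeleton-has-25134 (All.map proj₁ ok) len ss⊆σ offsets)

-- Proper patterns of π m are in the class

Before : ℕ → Pos → Set
Before c (T i) = i < c
Before c (B i) = i < c
Before c E0    = ⊥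
Before c E1    = ⊥
Before c E2    = ⊥
Before c _     = ⊤

oscillation-++ : ∀ j r s → oscillation j (r + s) ≡ oscillation j r ++ oscillation (j + r) s
oscillation-++ j zero    s = cong (λ i → oscillation i s) (sym (+-identityʳ j))
oscillation-++ j (suc r) s = cong (λ xs → T j ∷ B j ∷ xs) (begin
  oscillation (suc j) (r + s)                         ≡⟨ oscillation-++ (suc j) r s ⟩
  oscillation (suc j) r ++ oscillation (suc j + r) s  ≡⟨ cong (λ i → oscillation (suc j) r ++ oscillation i s) (sym (+-suc j r)) ⟩
  oscillation (suc j) r ++ oscillation (j + suc r) s  ∎)
  where open ≡-Reasoning

front : ℕ → List Pos
front c = F0 ∷ F1 ∷ F2 ∷ F3 ∷ oscillation 0 c

back : ℕ → ℕ → List Pos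
back c s = oscillation c s ++ ends

front-Before : ∀ c → All (Before c) (front c)
front-Before c = tt ∷ tt ∷ tt ∷ tt ∷ oscillation-below id id 0 c ≤-refl

positions-cut : ∀ c s → positions (c + s) ≡ front c ++ back c s
positions-cut c s = cong (λ xs → F0 ∷ F1 ∷ F2 ∷ F3 ∷ xs)
  (trans (cong (_++ ends) (oscillation-++ 0 c s)) (++-assoc (oscillation 0 c) (oscillation c s) ends))

-- The front misses E1, so it has no 321; the back misses F1, so it has no 25134.
cut-SumSplit : ∀ {m qs} c s → 1 ≤ m → c + s ≡ m → qs ⊆ positions m →
  (∀ {p q} → p ∈ qs → q ∈ qs → Inversion m p q → Before c p → Beyond c q → ⊥) → SumSplit (map (value m) qs)
cut-SumSplit {m} {qs} c s m≥1 refl qs⊆ no-crossing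
  with lower , upper , refl , lower⊆ , upper⊆ ← ⊆-++⁻ (front c) (back c s) (subst (qs ⊆_) (positions-cut c s) qs⊆) =
  record
    { lower          = map (value m) lower
    ; upper          = map (value m) upper
    ; split          = map-++ (value m) lower upper
    ; lower<upper    = lower<upper
    ; lower-no-321   = before ∘ E1∈lower
    ; upper-no-25134 = beyond ∘ F1∈upper
    }
  where
  before : ∀ {p} → p ∈ lower → Before c p
  before p∈ = All.lookup (front-Before c) (Any-resp-⊆ lower⊆ p∈)
  beyond : ∀ {q} → q ∈ upper → Beyond c q
  beyond q∈ = All.lookup (Beyond-oscillation c s) (Any-resp-⊆ upper⊆ q∈)
  E1∈lower : Has321 (map (value m) lower) → E1 ∈ lower
  E1∈lower h = All.lookup (Has321⇒E0E1E2 m≥1 (⊆-trans (++⁺ʳ upper ⊆-refl) qs⊆) h) (there (here refl))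
  F1∈upper : Has25134 (map (value m) upper) → F1 ∈ upper
  F1∈upper h = All.lookup (Has25134⇒F0F1F2F3B0 m≥1 (⊆-trans (++⁺ˡ lower ⊆-refl) qs⊆) h) (there (here refl))
  lower<upper : ∀ {x y} → x ∈ map (value m) lower → y ∈ map (value m) upper → x < y
  lower<upper x∈ y∈ with p , p∈ , refl ← ∈-map⁻ (value m) x∈ | q , q∈ , refl ← ∈-map⁻ (value m) y∈
    with AllPairs-++-cross (AllPairs-resp-⊆ qs⊆ (positions-classified m m≥1)) p∈ q∈
  ... | inj₁ p<q = p<q
  ... | inj₂ pq  = ⊥-elim (no-crossing (∈-++⁺ˡ p∈) (∈-++⁺ʳ lower q∈) pq (before p∈) (beyond q∈))

-- The only inversions across a cut run from T j to B (j + 1) or E2, or from F1 to B 0; each of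
-- them involves the deleted entry.
crossing-after-T : ∀ {j p q} → j < m → Inversion m p q → Before (suc j) p → Beyond (suc j) q → p ≡ T j
crossing-after-T _   F1-B0        _      ()
crossing-after-T _   T-B          j′≤j   j<j′   = ⊥-elim (<-irrefl refl (≤-trans j<j′ (≤-pred j′≤j)))
crossing-after-T _   (T-B⁺ _)     j′≤j   j≤j′   = cong T (≤-antisym (≤-pred j′≤j) (≤-pred j≤j′))
crossing-after-T j<m (T-E2 refl)  j′≤j   _      = cong T (≤-antisym (≤-pred j′≤j) (≤-pred j<m))

crossing-before-B : ∀ {j p q} → j < m → Inversion m p q → Before j p → Beyond j q → q ≡ B j
crossing-before-B _   F1-B0        _      j≤0    = cong B (sym (n≤0⇒n≡0 j≤0))
crossing-before-B _   T-B          j′<j   j≤j′   = ⊥-elim (<-irrefl refl (<-≤-trans j′<j j≤j′))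
crossing-before-B _   (T-B⁺ _)     j′<j   j≤sj′  = cong B (≤-antisym j′<j j≤sj′)
crossing-before-B j<m (T-E2 refl)  j′<j   _      = ⊥-elim (<-irrefl refl (<-≤-trans j′<j (≤-pred j<m)))

crossing-before-E2 : ∀ {p q} → 1 ≤ m → Inversion m p q → Before m p → Beyond m q → q ≡ E2
crossing-before-E2 m≥1 F1-B0        _     m≤0     = ⊥-elim (<-irrefl refl (≤-trans m≥1 m≤0))
crossing-before-E2 _   T-B          j<m   m≤j     = ⊥-elim (<-irrefl refl (<-≤-trans j<m m≤j))
crossing-before-E2 _   (T-B⁺ sj<m)  _     m≤sj    = ⊥-elim (<-irrefl refl (<-≤-trans sj<m m≤sj))
crossing-before-E2 _   (T-E2 _)     _     _       = refl

deletion-SumSplit : ∀ {m qs x} → 1 ≤ m → qs ⊆ positions m → x ∈ positions m → x ∉ qs →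
                    SumSplit (map (value m) qs)
deletion-SumSplit {x = F0} m≥1 qs⊆ _ x∉ =
  upper-SumSplit (λ h → x∉ (All.lookup (Has25134⇒F0F1F2F3B0 m≥1 qs⊆ h) (here refl)))
deletion-SumSplit {x = F1} m≥1 qs⊆ _ x∉ =
  upper-SumSplit (λ h → x∉ (All.lookup (Has25134⇒F0F1F2F3B0 m≥1 qs⊆ h) (there (here refl))))
deletion-SumSplit {x = F2} m≥1 qs⊆ _ x∉ =
  upper-SumSplit (λ h → x∉ (All.lookup (Has25134⇒F0F1F2F3B0 m≥1 qs⊆ h) (there (there (here refl)))))
deletion-SumSplit {x = F3} m≥1 qs⊆ _ x∉ =
  upper-SumSplit (λ h → x∉ (All.lookup (Has25134⇒F0F1F2F3B0 m≥1 qs⊆ h) (there (there (there (here refl))))))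
deletion-SumSplit {x = E0} m≥1 qs⊆ _ x∉ =
  lower-SumSplit (λ h → x∉ (All.lookup (Has321⇒E0E1E2 m≥1 qs⊆ h) (here refl)))
deletion-SumSplit {x = E1} m≥1 qs⊆ _ x∉ =
  lower-SumSplit (λ h → x∉ (All.lookup (Has321⇒E0E1E2 m≥1 qs⊆ h) (there (here refl))))
deletion-SumSplit {m} {qs} {T j} m≥1 qs⊆ x∈ x∉ =
  cut-SumSplit (suc j) (m ∸ suc j) m≥1 (m+[n∸m]≡n j<m) qs⊆ (λ p∈ _ pq p-before q-beyond →
    x∉ (subst (_∈ qs) (crossing-after-T j<m pq p-before q-beyond) p∈))
  where j<m = All.lookup (positions-valid m) x∈
deletion-SumSplit {m} {qs} {B j} m≥1 qs⊆ x∈ x∉ =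
  cut-SumSplit j (m ∸ j) m≥1 (m+[n∸m]≡n (<⇒≤ j<m)) qs⊆ (λ _ q∈ pq p-before q-beyond →
    x∉ (subst (_∈ qs) (crossing-before-B j<m pq p-before q-beyond) q∈))
  where j<m = All.lookup (positions-valid m) x∈
deletion-SumSplit {m} {qs} {E2} m≥1 qs⊆ _ x∉ =
  cut-SumSplit m 0 m≥1 (+-identityʳ m) qs⊆ (λ _ q∈ pq p-before q-beyond →
    x∉ (subst (_∈ qs) (crossing-before-E2 m≥1 pq p-before q-beyond) q∈))

proper-pattern∈𝒞 : ∀ {σ} → 1 ≤ m → Perm σ → σ ≼ π m → σ ≢ π m → 𝒞 σ
proper-pattern∈𝒞 {m} {σ} m≥1 σ↭ (τ , τ⊆π , σ≅τ) σ≢π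
  with qs , qs⊆ , refl ← ⊆-map⁻ (value m) (positions m) τ⊆π
  with length qs <? length (positions m)
... | yes shorter with x , x∈ , x∉ ← ⊆-missing qs⊆ (positions-unique m≥1) shorter =
  SumSplit⇒𝒞 σ↭ (OrdIso⇒≅ σ≅τ) (deletion-SumSplit m≥1 qs⊆ x∈ x∉)
... | no ¬shorter =
  ⊥-elim (σ≢π (≅-Perm⇒≡ σ↭ (π-Perm m m≥1) σ≅π))
  where
  σ≅π : σ ≅ π m
  σ≅π = subst (λ ps → σ ≅ map (value m) ps) (⊆-full qs⊆ (≮⇒≥ ¬shorter)) (OrdIso⇒≅ σ≅τ)

π-minimal : ∀ k → MinimalNonMember 𝒞 (π (2 + k))
π-minimal k = π-Perm (2 + k) (s≤s z≤n) , π∉𝒞 k , λ _ → proper-pattern∈𝒞 {2 + k} (s≤s z≤n)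

theorem6p1 : ¬ FinitelyBased (Wreath (Av ((2 ∷ 5 ∷ 1 ∷ 3 ∷ 4 ∷ []) ∷ [])) (Av ((3 ∷ 2 ∷ 1 ∷ []) ∷ [])))
theorem6p1 (L , complete) =
  <⇒≱ longer (All.lookup (xs≤max 0 (map length L)) (∈-map⁺ length (complete (π (2 + k)) (π-minimal k))))
  where
  k = max 0 (map length L)
  longer : k < length (π (2 + k))
  longer = subst (k <_) (sym (length-π (2 + k))) (s≤s (m≤n⇒m≤o+n 6 (≤-trans (m≤n+m k 2) (n≤double (2 + k)))))
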